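{- Let $\Gamma$ be a totally ordered additive abelian group, $\overline{\Gamma}=\Gamma\sqcup\{\infty\}$, $E$ a finite set and $\nu\colon\Delta_E^r\to\overline{\Gamma}$ a function. For $s\in E$ let $a_s$ be the minimal non-negative integer with $a_s\ge\alpha_s$ for all $\alpha\in\Delta_E^r$ with $\nu(\alpha)\ne\infty$. Let $\pi\colon E'\to E$ be a map of finite sets with $|\pi^{ -1}(s)|=a_s$ for all $s\in E$, and define the multisymmetric lift $M_\pi(\nu)\colon\binom{E'}{r}\to\overline{\Gamma}$ by $M_\pi(\nu)(S')=\nu\big(\sum_{s'\in S'}e_{\pi(s')}\big)$. Then $\nu$ is $M$-convex if and only if $M_\pi(\nu)$ is a valuated matroid (of rank $r$ on $E'$).
   Context: $e_s\in\mathbb{Z}^E$ is the standard basis vector, $\Delta_E^r=\{\alpha\in\mathbb{Z}_{\ge0}^E\mid\sum_e\alpha_e=r\}$, $\binom{E'}{r}$ is the set of $r$-element subsets of $E'$. An $M$-convex function of rank $r$ is a function $\nu\colon\Delta_E^r\to\overline{\Gamma}$, not identically $\infty$, such that for all $\alpha,\beta\in\Delta_E^r$ and $s\in E$ with $\alpha_s>\beta_s$ there exists $t\in E$ with $\beta_t>\alpha_t$ and $\nu(\alpha)+\nu(\beta)\ge\nu(\alpha-e_s+e_t)+\nu(\beta-e_t+e_s)$. A valuated matroid of rank $r$ on a finite set $X$ is a map $\mu\colon\binom{X}{r}\to\overline{\Gamma}$, not identically $\infty$, such that for all $S,T\in\binom{X}{r}$ and $s\in S\setminus T$ there is $t\in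 T\setminus S$ with $\mu(S)+\mu(T)\ge\mu((S\setminus\{s\})\cup\{t\})+\mu((T\setminus\{t\})\cup\{s\})$. Here $\infty$ exceeds all elements of $\Gamma$ and $\infty+a=\infty$. -}

module Defs where

open import Level using (Level; suc; _⊔_)
open import Data.Nat using (ℕ) renaming (suc to sucℕ; pred to predℕ; _≤_ to _≤ℕ_; _<_ to _<ℕ_)
open import Data.Nat.Properties using (_≟_)
open import Data.Fin using (Fin)
open import Data.Fin.Subset using (Subset; ∣_∣; _∈_; _∉_)
open import Data.Vec using (Vec; lookup; tabulate; sum; _[_]%=_; _[_]≔_)
open import Data.Bool using (Bool; true; false)
open import Data.Product using (Σ; _×_; ∃; ∃-syntax)
open import Relation.Nullary using (¬_)
open import Relation.Nullary.Decidable using (⌊_⌋)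
open import Relation.Binary using (Rel; IsTotalOrder)
open import Relation.Binary.PropositionalEquality using (_≡_; _≢_)
import Data.Fin.Properties as FinP

record TotallyOrderedAbelianGroup (c ℓ : Level) : Set (suc (c ⊔ ℓ)) where
  infixl 6 _+_
  infix 4 _≤_
  field
    Carrier     : Set c
    _+_         : Carrier → Carrier → Carrier
    0#          : Carrier
    -_          : Carrier → Carrier
    +-assoc     : ∀ x y z → (x + y) + z ≡ x + (y + z)
    +-comm      : ∀ x y → x + y ≡ y + x
    +-identityˡ : ∀ x → 0# + x ≡ x
    -‿inverseˡ  : ∀ x → (- x) + x ≡ 0#
    _≤_         : Rel Carrier ℓ
    isTotalOrder : IsTotalOrder _≡_ _≤_
    +-monoˡ-≤   : ∀ {x y} z → x ≤ y → x + z ≤ y + z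

module _ {c ℓ} (Γ : TotallyOrderedAbelianGroup c ℓ) where
  open TotallyOrderedAbelianGroup Γ

  data Γ̄ : Set c where
    fin : Carrier → Γ̄
    ∞   : Γ̄

  infixl 6 _+̄_
  _+̄_ : Γ̄ → Γ̄ → Γ̄
  fin x +̄ fin y = fin (x + y)
  fin x +̄ ∞     = ∞
  ∞     +̄ _     = ∞

  infix 4 _≤̄_
  data _≤̄_ : Γ̄ → Γ̄ → Set (c ⊔ ℓ) where
    fin≤fin : ∀ {x y} → x ≤ y → fin x ≤̄ fin y
    _≤∞     : ∀ u → u ≤̄ ∞

InΔ : ∀ {n} → ℕ → Vec ℕ n → Set
InΔ r α = sum α ≡ r

exch : ∀ {n} → Vec ℕ n → Fin n → Fin n → Vec ℕ n
exch α s t = (α [ s ]%= predℕ) [ t ]%= sucℕ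

module _ {c ℓ} (Γ : TotallyOrderedAbelianGroup c ℓ) where

  -- M-convex function of rank r (only values on Δ_E^r are consulted)
  IsMConvex : ∀ {n} → ℕ → (Vec ℕ n → Γ̄ Γ) → Set (c ⊔ ℓ)
  IsMConvex {n} r ν =
    (∃[ α ] (InΔ r α × ν α ≢ ∞))
    × (∀ α β → InΔ r α → InΔ r β → (s : Fin n) → lookup β s <ℕ lookup α s →
         ∃[ t ] (lookup α t <ℕ lookup β t
                 × _≤̄_ Γ (_+̄_ Γ (ν (exch α s t)) (ν (exch β t s)))
                          (_+̄_ Γ (ν α) (ν β))))

  -- Valuated matroid of rank r on Fin m (only values on r-subsets consulted)
  IsValuatedMatroid : ∀ {m} → ℕ → (Subset m → Γ̄ Γ) → Set (c ⊔ ℓ)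
  IsValuatedMatroid {m} r μ =
    (∃[ S ] (∣ S ∣ ≡ r × μ S ≢ ∞))
    × (∀ S T → ∣ S ∣ ≡ r → ∣ T ∣ ≡ r → (s : Fin m) → s ∈ S → s ∉ T →
         ∃[ t ] (t ∈ T × t ∉ S
                 × _≤̄_ Γ (_+̄_ Γ (μ ((S [ s ]≔ false) [ t ]≔ true))
                                (μ ((T [ t ]≔ false) [ s ]≔ true)))
                          (_+̄_ Γ (μ S) (μ T))))

  IsUpperBound : ∀ {n} → ℕ → (Vec ℕ n → Γ̄ Γ) → Fin n → ℕ → Set c
  IsUpperBound r ν s b = ∀ α → InΔ r α → ν α ≢ ∞ → lookup α s ≤ℕ b

  IsMinimalBound : ∀ {n} → ℕ → (Vec ℕ n → Γ̄ Γ) → (Fin n → ℕ) → Set c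
  IsMinimalBound r ν a =
    ∀ s → IsUpperBound r ν s (a s) × (∀ b → IsUpperBound r ν s b → a s ≤ℕ b)

fiber : ∀ {m n} → (Fin m → Fin n) → Fin n → Subset m
fiber π s = tabulate (λ s' → ⌊ FinP._≟_ (π s') s ⌋)

-- Σ_{s' ∈ S'} e_{π(s')} : its s-th coordinate counts s' ∈ S' with π s' = s
liftVec : ∀ {m n} → (Fin m → Fin n) → Subset m → Vec ℕ n
liftVec π S = tabulate (λ s → ∣ S Data.Fin.Subset.∩ fiber π s ∣)

M : ∀ {a} {A : Set a} {m n} → (Fin m → Fin n) → (Vec ℕ n → A) → Subset m → A
M π ν S = ν (liftVec π S)

{-# OPTIONS --safe #-}
-- Let L = liftVec π, so L S = Σ_{s′∈S} e_{π s′}. Removing x from S and adding y changes L S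
-- by −e_{π x} + e_{π y}, so exchanges of subsets map to exchanges of vectors, and exchange
-- inequalities transfer between ν and M_π(ν) = ν ∘ L as long as the vectors involved have
-- preimages under L.
-- From M-convexity: given s ∈ S ∖ T, if the fiber of s is fuller in S than in T, exchange L S and
-- L T at π s and pick a preimage in T ∖ S of the coordinate t returned; otherwise trade s for an
-- element of T ∖ S in its own fiber, which changes neither L S nor L T.
-- Towards M-convexity: every finite α fits into the fibers (this is what the bounds a give), and
-- the greedy preimages of α and β are nested in each fiber, so an element of T ∖ S returned by the
-- matroid exchange lies in a fiber t with α t < β t. When ν α or ν β is ∞ the inequality is
-- trivial and a coordinate with α t < β t exists because Σ α = Σ β.
module Submission where

open import Defs
open import Level using (_⊔_)
open import Data.Nat using (ℕ; zero; suc; pred; _+_; _≤_; _<_; z≤n; _<?_)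
open import Data.Nat.Properties
  using (+-suc; +-mono-≤; +-mono-<-≤; +-mono-≤-<; <-≤-trans; <⇒≢; <⇒≱; ≮⇒≥; ≰⇒>; n≤0⇒n≡0; pred-mono-≤)
open import Data.Fin using (Fin; zero; suc)
open import Data.Fin.Properties using (any?) renaming (_≟_ to _≟ᶠ_)
open import Data.Fin.Subset using (Subset; ⊤; _∩_; _∈_; _∉_; _⊆_; ∣_∣)
open import Data.Fin.Subset.Properties using (_∈?_; p⊆q⇒∣p∣≤∣q∣; x∈p∩q⁺; x∈p∩q⁻; ∩-identityˡ)
open import Data.Vec using (Vec; []; _∷_; here; there; lookup; tabulate; sum; _[_]≔_; _[_]%=_)
open import Data.Vec.Properties
  using (lookup∘tabulate; lookup∘updateAt; lookup∘updateAt′; lookup∘update′; updateAt-id-local;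
         []%=-∘; []%=-id; []=⇒lookup; lookup⇒[]=; []=-injective; []≔-updates; []≔-minimal;
         []≔-idempotent; []≔-lookup)
open import Data.Vec.Relation.Binary.Pointwise.Extensional using (ext; Pointwise-≡⇒≡)
open import Data.Bool using (true; false; _∧_)
open import Data.Bool.Properties using (∧-zeroʳ)
open import Data.Product using (_×_; _,_; proj₁; map₂; ∃-syntax)
open import Data.Sum using (_⊎_; inj₁; inj₂)
open import Function using (_∘_)
open import Function.Bundles using (_⇔_; mk⇔)
open import Relation.Binary using (IsTotalOrder)
open import Relation.Binary.PropositionalEquality
  using (_≡_; _≢_; refl; sym; trans; cong; subst; subst₂; module ≡-Reasoning)
open import Relation.Nullary using (Dec; does; yes; no; contradiction)
open import Relation.Nullary.Decidable
  using (⌊_⌋; ¬?; _×-dec_; decidable-stable; dec-true; dec-false; isYes≗does)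

open ≡-Reasoning

exch-self : ∀ {n} (α : Vec ℕ n) s {k} → lookup α s ≡ suc k → exch α s s ≡ α
exch-self α s α[s]≡1+k =
  trans ([]%=-∘ α s)
        (updateAt-id-local s α (trans (cong (λ (a : ℕ) → suc (pred a)) α[s]≡1+k) (sym α[s]≡1+k)))

[]%=suc-pred : ∀ {n} (v : Vec ℕ n) i → v [ i ]%= suc [ i ]%= pred ≡ v
[]%=suc-pred v i = trans ([]%=-∘ v i) ([]%=-id v i)

[]%=pred-mono : ∀ {n} (α β : Vec ℕ n) i {u} → lookup α u ≤ lookup β u →
                lookup (α [ i ]%= pred) u ≤ lookup (β [ i ]%= pred) u
[]%=pred-mono α β i {u} α≤β with u ≟ᶠ i
... | yes refl = subst₂ _≤_ (sym (lookup∘updateAt i α)) (sym (lookup∘updateAt i β)) (pred-mono-≤ α≤β)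
... | no u≢i   = subst₂ _≤_ (sym (lookup∘updateAt′ u i u≢i α)) (sym (lookup∘updateAt′ u i u≢i β)) α≤β

[]%=pred-≤ : ∀ {n} (α w : Vec ℕ n) i → (∀ u → lookup α u ≤ lookup (w [ i ]%= suc) u) →
             ∀ u → lookup (α [ i ]%= pred) u ≤ lookup w u
[]%=pred-≤ α w i α≤ u =
  subst (lookup (α [ i ]%= pred) u ≤_) (cong (λ v → lookup v u) ([]%=suc-pred w i))
        ([]%=pred-mono α (w [ i ]%= suc) i (α≤ u))

sum-tabulate-0 : ∀ n → sum (tabulate {n = n} (λ _ → 0)) ≡ 0
sum-tabulate-0 zero    = refl
sum-tabulate-0 (suc n) = sum-tabulate-0 n

sum-[]%=suc : ∀ {n} (v : Vec ℕ n) i → sum (v [ i ]%= suc) ≡ suc (sum v)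
sum-[]%=suc (x ∷ v) zero    = refl
sum-[]%=suc (x ∷ v) (suc i) = trans (cong (x +_) (sum-[]%=suc v i)) (+-suc x (sum v))

sum-mono-≤ : ∀ {n} (α β : Vec ℕ n) → (∀ t → lookup β t ≤ lookup α t) → sum β ≤ sum α
sum-mono-≤ []      []      β≤α = z≤n
sum-mono-≤ (a ∷ α) (b ∷ β) β≤α = +-mono-≤ (β≤α zero) (sum-mono-≤ α β (β≤α ∘ suc))

sum-mono-< : ∀ {n} (α β : Vec ℕ n) s → (∀ t → lookup β t ≤ lookup α t) → lookup β s < lookup α s →
             sum β < sum α
sum-mono-< (a ∷ α) (b ∷ β) zero    β≤α b<a = +-mono-<-≤ b<a (sum-mono-≤ α β (β≤α ∘ suc))
sum-mono-< (a ∷ α) (b ∷ β) (suc s) β≤α β<α = +-mono-≤-< (β≤α zero) (sum-mono-< α β s (β≤α ∘ suc) β<α)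

sum≡∧>⇒∃< : ∀ {n} (α β : Vec ℕ n) s → sum α ≡ sum β → lookup β s < lookup α s →
            ∃[ t ] lookup α t < lookup β t
sum≡∧>⇒∃< α β s Σα≡Σβ β<α with any? (λ t → lookup α t <? lookup β t)
... | yes t = t
... | no none = contradiction (sym Σα≡Σβ)
                  (<⇒≢ (sum-mono-< α β s (λ t → ≮⇒≥ (λ α<β → none (t , α<β))) β<α))

swap : ∀ {m} → Subset m → Fin m → Fin m → Subset m
swap S s t = (S [ s ]≔ false) [ t ]≔ true

∣p∣<∣q∣⇒∃∈q∉p : ∀ {m} {p q : Subset m} → ∣ p ∣ < ∣ q ∣ → ∃[ x ] (x ∈ q × x ∉ p)
∣p∣<∣q∣⇒∃∈q∉p {p = p} {q} ∣p∣<∣q∣ with any? (λ x → x ∈? q ×-dec ¬? (x ∈? p))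
... | yes witness = witness
... | no none     = contradiction (p⊆q⇒∣p∣≤∣q∣ q⊆p) (<⇒≱ ∣p∣<∣q∣)
  where
  q⊆p : q ⊆ p
  q⊆p {x} x∈q = decidable-stable (x ∈? p) (λ x∉p → none (x , x∈q , x∉p))

∉-[]≔false : ∀ {m} (p : Subset m) x → x ∉ p [ x ]≔ false
∉-[]≔false p x x∈ with []=-injective ([]≔-updates p x) x∈
... | ()

∈-[]≔⁻ : ∀ {m} (p : Subset m) {x y} b → y ≢ x → y ∈ p [ x ]≔ b → y ∈ p
∈-[]≔⁻ p {y = y} b y≢x y∈ = lookup⇒[]= y p (trans (sym (lookup∘update′ y≢x p b)) ([]=⇒lookup y∈))

[]≔false-[]≔true : ∀ {m} (p : Subset m) {x} → x ∈ p → (p [ x ]≔ false) [ x ]≔ true ≡ p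
[]≔false-[]≔true p {x} x∈p =
  trans ([]≔-idempotent p x) (trans (cong (p [ x ]≔_) (sym ([]=⇒lookup x∈p))) ([]≔-lookup p x))

[]≔-∩-∉ : ∀ {m} (p q : Subset m) {x} b → x ∉ q → (p [ x ]≔ b) ∩ q ≡ p ∩ q
[]≔-∩-∉ (c ∷ p) (true ∷ q)  {zero}  b x∉q = contradiction here x∉q
[]≔-∩-∉ (c ∷ p) (false ∷ q) {zero}  b x∉q = cong (_∷ p ∩ q) (trans (∧-zeroʳ b) (sym (∧-zeroʳ c)))
[]≔-∩-∉ (c ∷ p) (d ∷ q)     {suc x} b x∉q = cong (c ∧ d ∷_) ([]≔-∩-∉ p q b (x∉q ∘ there))

∣[]≔true∩∣ : ∀ {m} (p q : Subset m) {x} → x ∉ p → x ∈ q → ∣ (p [ x ]≔ true) ∩ q ∣ ≡ suc ∣ p ∩ q ∣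
∣[]≔true∩∣ (true ∷ p)  q           {zero}  x∉p _           = contradiction here x∉p
∣[]≔true∩∣ (false ∷ p) (true ∷ q)  {zero}  _   here        = refl
∣[]≔true∩∣ (c ∷ p)     (d ∷ q)     {suc x} x∉p (there x∈q) with c ∧ d
... | true  = cong suc (∣[]≔true∩∣ p q (x∉p ∘ there) x∈q)
... | false = ∣[]≔true∩∣ p q (x∉p ∘ there) x∈q

module _ {m n} (π : Fin m → Fin n) where

  lookup-fiber : ∀ x u → lookup (fiber π u) x ≡ does (π x ≟ᶠ u)
  lookup-fiber x u = trans (lookup∘tabulate _ x) (isYes≗does (π x ≟ᶠ u))

  ∉-fiber : ∀ {x u} → π x ≢ u → x ∉ fiber π u
  ∉-fiber {x} {u} πx≢u x∈F
    with trans (sym ([]=⇒lookup x∈F)) (trans (lookup-fiber x u) (dec-false (π x ≟ᶠ u) πx≢u))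
  ... | ()

  ∈-fiber : ∀ x → x ∈ fiber π (π x)
  ∈-fiber x = lookup⇒[]= x _ (trans (lookup-fiber x (π x)) (dec-true (π x ≟ᶠ π x) refl))

  ∈-fiber⁻ : ∀ {x u} → x ∈ fiber π u → π x ≡ u
  ∈-fiber⁻ {x} {u} x∈F = decidable-stable (π x ≟ᶠ u) (λ πx≢u → ∉-fiber πx≢u x∈F)

  lookup-liftVec : ∀ S u → lookup (liftVec π S) u ≡ ∣ S ∩ fiber π u ∣
  lookup-liftVec S u = lookup∘tabulate _ u

  lookup-liftVec-⊤ : ∀ u → lookup (liftVec π ⊤) u ≡ ∣ fiber π u ∣
  lookup-liftVec-⊤ u = trans (lookup-liftVec ⊤ u) (cong ∣_∣ (∩-identityˡ (fiber π u)))

  liftVec-insert : ∀ {S x} → x ∉ S → liftVec π (S [ x ]≔ true) ≡ liftVec π S [ π x ]%= suc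
  liftVec-insert {S} {x} x∉S = Pointwise-≡⇒≡ (ext lookup-insert)
    where
    lookup-insert : ∀ u → lookup (liftVec π (S [ x ]≔ true)) u ≡ lookup (liftVec π S [ π x ]%= suc) u
    lookup-insert u with u ≟ᶠ π x
    ... | yes refl = begin
      lookup (liftVec π (S [ x ]≔ true)) (π x) ≡⟨ lookup-liftVec (S [ x ]≔ true) (π x) ⟩
      ∣ (S [ x ]≔ true) ∩ fiber π (π x) ∣      ≡⟨ ∣[]≔true∩∣ S _ x∉S (∈-fiber x) ⟩
      suc ∣ S ∩ fiber π (π x) ∣                ≡⟨ cong suc (lookup-liftVec S (π x)) ⟨
      suc (lookup (liftVec π S) (π x))         ≡⟨ lookup∘updateAt (π x) (liftVec π S) ⟨
      lookup (liftVec π S [ π x ]%= suc) (π x) ∎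
    ... | no u≢πx = begin
      lookup (liftVec π (S [ x ]≔ true)) u ≡⟨ lookup-liftVec (S [ x ]≔ true) u ⟩
      ∣ (S [ x ]≔ true) ∩ fiber π u ∣      ≡⟨ cong ∣_∣ ([]≔-∩-∉ S _ true (∉-fiber (u≢πx ∘ sym))) ⟩
      ∣ S ∩ fiber π u ∣                    ≡⟨ lookup-liftVec S u ⟨
      lookup (liftVec π S) u               ≡⟨ lookup∘updateAt′ u (π x) u≢πx (liftVec π S) ⟨
      lookup (liftVec π S [ π x ]%= suc) u ∎

  liftVec-delete : ∀ {S x} → x ∈ S → liftVec π S ≡ liftVec π (S [ x ]≔ false) [ π x ]%= suc
  liftVec-delete {S} {x} x∈S = begin
    liftVec π S                                   ≡⟨ cong (liftVec π) ([]≔false-[]≔true S x∈S) ⟨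
    liftVec π ((S [ x ]≔ false) [ x ]≔ true)      ≡⟨ liftVec-insert (∉-[]≔false S x) ⟩
    liftVec π (S [ x ]≔ false) [ π x ]%= suc      ∎

  liftVec-delete-at : ∀ {S x} → x ∈ S →
                      lookup (liftVec π S) (π x) ≡ suc (lookup (liftVec π (S [ x ]≔ false)) (π x))
  liftVec-delete-at {S} {x} x∈S =
    trans (cong (λ v → lookup v (π x)) (liftVec-delete x∈S))
          (lookup∘updateAt (π x) (liftVec π (S [ x ]≔ false)))

  liftVec-swap : ∀ {S x y} → x ∈ S → y ∉ S → liftVec π (swap S x y) ≡ exch (liftVec π S) (π x) (π y)
  liftVec-swap {S} {x} {y} x∈S y∉S = begin
    liftVec π (swap S x y)                       ≡⟨ liftVec-insert (y∉S ∘ ∈-[]≔⁻ S false y≢x) ⟩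
    liftVec π (S [ x ]≔ false) [ π y ]%= suc     ≡⟨ cong (_[ π y ]%= suc) deleted ⟨
    exch (liftVec π S) (π x) (π y)               ∎
    where
    y≢x : y ≢ x
    y≢x refl = y∉S x∈S
    deleted : liftVec π S [ π x ]%= pred ≡ liftVec π (S [ x ]≔ false)
    deleted = trans (cong (_[ π x ]%= pred) (liftVec-delete x∈S)) ([]%=suc-pred _ (π x))

  liftVec-witness : ∀ S T u → lookup (liftVec π S) u < lookup (liftVec π T) u →
                    ∃[ x ] (x ∈ T × x ∉ S × π x ≡ u)
  liftVec-witness S T u S<T
    with ∣p∣<∣q∣⇒∃∈q∉p (subst₂ _<_ (lookup-liftVec S u) (lookup-liftVec T u) S<T)
  ... | x , x∈T∩F , x∉S∩F with x∈p∩q⁻ T (fiber π u) x∈T∩F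
  ...   | x∈T , x∈F = x , x∈T , (λ x∈S → x∉S∩F (x∈p∩q⁺ (x∈S , x∈F))) , ∈-fiber⁻ x∈F

  fiber-exchange : ∀ S T {s} → s ∈ S → s ∉ T →
                   lookup (liftVec π S) (π s) ≤ lookup (liftVec π T) (π s) →
                   ∃[ t ] (t ∈ T × t ∉ S × liftVec π (swap S s t) ≡ liftVec π S
                                          × liftVec π (swap T t s) ≡ liftVec π T)
  fiber-exchange S T {s} s∈S s∉T S≤T
    with liftVec-witness (S [ s ]≔ false) T (π s)
           (subst (_≤ lookup (liftVec π T) (π s)) (liftVec-delete-at s∈S) S≤T)
  ... | t , t∈T , t∉S-s , πt≡πs = t , t∈T , t∉S , S-unchanged , T-unchanged
    where
    t≢s : t ≢ s
    t≢s refl = s∉T t∈T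
    t∉S : t ∉ S
    t∉S = t∉S-s ∘ []≔-minimal S t s t≢s
    S-unchanged : liftVec π (swap S s t) ≡ liftVec π S
    S-unchanged = trans (liftVec-swap s∈S t∉S)
      (trans (cong (exch (liftVec π S) (π s)) πt≡πs) (exch-self _ (π s) (liftVec-delete-at s∈S)))
    T-unchanged : liftVec π (swap T t s) ≡ liftVec π T
    T-unchanged = trans (liftVec-swap t∈T s∉T)
      (trans (cong (exch (liftVec π T) (π t)) (sym πt≡πs)) (exch-self _ (π t) (liftVec-delete-at t∈T)))

liftVec-true∷ : ∀ {m n} (π : Fin (suc m) → Fin n) S →
                liftVec π (true ∷ S) ≡ liftVec (π ∘ suc) S [ π zero ]%= suc
liftVec-true∷ π S = liftVec-insert π {false ∷ S} {zero} (λ ())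

sum-liftVec : ∀ {m n} (π : Fin m → Fin n) S → sum (liftVec π S) ≡ ∣ S ∣
sum-liftVec {n = n} π []  = sum-tabulate-0 n
sum-liftVec π (false ∷ S) = sum-liftVec (π ∘ suc) S
sum-liftVec π (true ∷ S)  = begin
  sum (liftVec π (true ∷ S))                   ≡⟨ cong sum (liftVec-true∷ π S) ⟩
  sum (liftVec (π ∘ suc) S [ π zero ]%= suc)   ≡⟨ sum-[]%=suc (liftVec (π ∘ suc) S) (π zero) ⟩
  suc (sum (liftVec (π ∘ suc) S))              ≡⟨ cong suc (sum-liftVec (π ∘ suc) S) ⟩
  suc ∣ S ∣                                    ∎

-- The first α u elements of each fiber π⁻¹(u).
greedyLift : ∀ {m n} → (Fin m → Fin n) → Vec ℕ n → Subset m
greedyLift {zero}  π α = []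
greedyLift {suc m} π α = ⌊ 0 <? lookup α (π zero) ⌋ ∷ greedyLift (π ∘ suc) (α [ π zero ]%= pred)

liftVec-greedyLift : ∀ {m n} (π : Fin m → Fin n) α → (∀ u → lookup α u ≤ lookup (liftVec π ⊤) u) →
                     liftVec π (greedyLift π α) ≡ α
liftVec-greedyLift {zero} π α α≤0 = Pointwise-≡⇒≡ (ext λ u →
  trans (lookup-liftVec π [] u) (sym (n≤0⇒n≡0 (subst (lookup α u ≤_) (lookup-liftVec π [] u) (α≤0 u)))))
liftVec-greedyLift {suc m} π α α≤
  with lookup α (π zero) in α₀≡
     | liftVec-greedyLift (π ∘ suc) (α [ π zero ]%= pred)
         ([]%=pred-≤ α (liftVec (π ∘ suc) ⊤) (π zero)
           (λ u → subst (λ v → lookup α u ≤ lookup v u) (liftVec-true∷ π ⊤) (α≤ u)))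
... | zero  | IH = trans IH (updateAt-id-local (π zero) α (trans (cong pred α₀≡) (sym α₀≡)))
... | suc _ | IH = begin
  liftVec π (true ∷ S′)                 ≡⟨ liftVec-true∷ π S′ ⟩
  liftVec (π ∘ suc) S′ [ π zero ]%= suc ≡⟨ cong (_[ π zero ]%= suc) IH ⟩
  exch α (π zero) (π zero)              ≡⟨ exch-self α (π zero) α₀≡ ⟩
  α                                     ∎
  where
  S′ : Subset m
  S′ = greedyLift (π ∘ suc) (α [ π zero ]%= pred)

greedyLift-mono : ∀ {m n} (π : Fin m → Fin n) {α β} x → lookup α (π x) ≤ lookup β (π x) →
                  x ∈ greedyLift π α → x ∈ greedyLift π β
greedyLift-mono π {α} {β} zero α≤β x∈ with 0 <? lookup α (π zero) | 0 <? lookup β (π zero)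
... | _       | yes _  = here
... | yes α>0 | no β≯0 = contradiction (<-≤-trans α>0 α≤β) β≯0
greedyLift-mono π zero α≤β () | no _ | no _
greedyLift-mono π {α} {β} (suc x) α≤β (there x∈) =
  there (greedyLift-mono (π ∘ suc) x ([]%=pred-mono α β (π zero) α≤β) x∈)

greedyLift-nested : ∀ {m n} (π : Fin m → Fin n) {α β y} →
                    y ∈ greedyLift π β → y ∉ greedyLift π α → lookup α (π y) < lookup β (π y)
greedyLift-nested π {y = y} y∈T y∉S = ≰⇒> (λ β≤α → y∉S (greedyLift-mono π y β≤α y∈T))

module _ {c ℓ} (Γ : TotallyOrderedAbelianGroup c ℓ) where
  open TotallyOrderedAbelianGroup Γ using (isTotalOrder)

  ≤̄-refl : ∀ x → _≤̄_ Γ x x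
  ≤̄-refl (fin x) = fin≤fin (IsTotalOrder.refl isTotalOrder)
  ≤̄-refl ∞       = ∞ ≤∞

  ≤̄-+̄∞ : ∀ z {x y} → x ≡ ∞ ⊎ y ≡ ∞ → _≤̄_ Γ z (_+̄_ Γ x y)
  ≤̄-+̄∞ z         (inj₁ refl) = z ≤∞
  ≤̄-+̄∞ z {fin x} (inj₂ refl) = z ≤∞
  ≤̄-+̄∞ z {∞}     (inj₂ refl) = z ≤∞

  ∞? : (x : Γ̄ Γ) → Dec (x ≡ ∞)
  ∞? (fin x) = no (λ ())
  ∞? ∞       = yes refl

  ExchangeIneq : {A : Set} → (A → Γ̄ Γ) → A → A → A → A → Set (c ⊔ ℓ)
  ExchangeIneq f x y x′ y′ = _≤̄_ Γ (_+̄_ Γ (f x′) (f y′)) (_+̄_ Γ (f x) (f y))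

  ExchangeableAt : ∀ {n} → (Vec ℕ n → Γ̄ Γ) → Vec ℕ n → Vec ℕ n → Fin n → Set (c ⊔ ℓ)
  ExchangeableAt ν α β s =
    ∃[ t ] (lookup α t < lookup β t × ExchangeIneq ν α β (exch α s t) (exch β t s))

  MConvexExchange : ∀ {n} → ℕ → (Vec ℕ n → Γ̄ Γ) → Set (c ⊔ ℓ)
  MConvexExchange {n} r ν =
    ∀ α β → InΔ r α → InΔ r β → (s : Fin n) → lookup β s < lookup α s → ExchangeableAt ν α β s

  MatroidExchange : ∀ {m} → ℕ → (Subset m → Γ̄ Γ) → Set (c ⊔ ℓ)
  MatroidExchange {m} r μ = ∀ S T → ∣ S ∣ ≡ r → ∣ T ∣ ≡ r → (s : Fin m) → s ∈ S → s ∉ T →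
    ∃[ t ] (t ∈ T × t ∉ S × ExchangeIneq μ S T (swap S s t) (swap T t s))

  exchangeableAt-∞ : ∀ {n r} (ν : Vec ℕ n → Γ̄ Γ) {α β} → InΔ r α → InΔ r β → ∀ s →
                     lookup β s < lookup α s → ν α ≡ ∞ ⊎ ν β ≡ ∞ → ExchangeableAt ν α β s
  exchangeableAt-∞ ν {α} {β} α∈Δ β∈Δ s β<α ∞-summand =
    map₂ (_, ≤̄-+̄∞ _ ∞-summand) (sum≡∧>⇒∃< α β s (trans α∈Δ (sym β∈Δ)) β<α)

  module _ {m n} (π : Fin m → Fin n) {r : ℕ} (ν : Vec ℕ n → Γ̄ Γ) where

    mConvex⇒matroidExchange : MConvexExchange r ν → MatroidExchange r (M π ν)
    mConvex⇒matroidExchange exchange S T ∣S∣≡r ∣T∣≡r s s∈S s∉T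
      with lookup (liftVec π T) (π s) <? lookup (liftVec π S) (π s)
    ... | no T≮S with fiber-exchange π S T s∈S s∉T (≮⇒≥ T≮S)
    ...   | t , t∈T , t∉S , S-unchanged , T-unchanged =
      t , t∈T , t∉S ,
      subst₂ (ExchangeIneq ν (liftVec π S) (liftVec π T)) (sym S-unchanged) (sym T-unchanged) (≤̄-refl _)
    mConvex⇒matroidExchange exchange S T ∣S∣≡r ∣T∣≡r s s∈S s∉T | yes T<S
      with exchange (liftVec π S) (liftVec π T) (trans (sum-liftVec π S) ∣S∣≡r)
                    (trans (sum-liftVec π T) ∣T∣≡r) (π s) T<S
    ... | t , S<T , ineq with liftVec-witness π S T t S<T
    ...   | x , x∈T , x∉S , refl =
      x , x∈T , x∉S ,
      subst₂ (ExchangeIneq ν (liftVec π S) (liftVec π T))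
             (sym (liftVec-swap π s∈S x∉S)) (sym (liftVec-swap π x∈T s∉T)) ineq

    nestedLifts⇒exchangeableAt :
      MatroidExchange r (M π ν) → ∀ {S T α β} → liftVec π S ≡ α → liftVec π T ≡ β →
      InΔ r α → InΔ r β → (∀ {y} → y ∈ T → y ∉ S → lookup α (π y) < lookup β (π y)) →
      ∀ s → lookup β s < lookup α s → ExchangeableAt ν α β s
    nestedLifts⇒exchangeableAt exchange {S} {T} refl refl α∈Δ β∈Δ nested s β<α
      with liftVec-witness π T S s β<α
    ... | x , x∈S , x∉T , refl
      with exchange S T (trans (sym (sum-liftVec π S)) α∈Δ) (trans (sym (sum-liftVec π T)) β∈Δ) x x∈S x∉T
    ...   | y , y∈T , y∉S , ineq =
      π y , nested y∈T y∉S ,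
      subst₂ (ExchangeIneq ν (liftVec π S) (liftVec π T))
             (liftVec-swap π x∈S y∉S) (liftVec-swap π y∈T x∉T) ineq

    module _ (fits : ∀ α → InΔ r α → ν α ≢ ∞ → ∀ u → lookup α u ≤ ∣ fiber π u ∣) where

      liftVec-greedyLift-finite : ∀ {α} → InΔ r α → ν α ≢ ∞ → liftVec π (greedyLift π α) ≡ α
      liftVec-greedyLift-finite {α} α∈Δ να≢∞ = liftVec-greedyLift π α (λ u →
        subst (lookup α u ≤_) (sym (lookup-liftVec-⊤ π u)) (fits α α∈Δ να≢∞ u))

      matroid⇒mConvexExchange : MatroidExchange r (M π ν) → MConvexExchange r ν
      matroid⇒mConvexExchange exchange α β α∈Δ β∈Δ s β<α with ∞? (ν α) | ∞? (ν β)
      ... | yes να≡∞ | _        = exchangeableAt-∞ ν α∈Δ β∈Δ s β<α (inj₁ να≡∞)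
      ... | no _     | yes νβ≡∞ = exchangeableAt-∞ ν α∈Δ β∈Δ s β<α (inj₂ νβ≡∞)
      ... | no να≢∞  | no νβ≢∞  =
        nestedLifts⇒exchangeableAt exchange
          (liftVec-greedyLift-finite α∈Δ να≢∞) (liftVec-greedyLift-finite β∈Δ νβ≢∞)
          α∈Δ β∈Δ (greedyLift-nested π) s β<α

      mConvex⇔valuatedMatroid : IsMConvex Γ r ν ⇔ IsValuatedMatroid Γ r (M π ν)
      mConvex⇔valuatedMatroid = mk⇔ to from
        where
        to : IsMConvex Γ r ν → IsValuatedMatroid Γ r (M π ν)
        to ((α , α∈Δ , να≢∞) , exchange) =
          (greedyLift π α , ∣S∣≡r , να≢∞ ∘ subst (λ v → ν v ≡ ∞) L[S]≡α) ,
          mConvex⇒matroidExchange exchange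
          where
          L[S]≡α : liftVec π (greedyLift π α) ≡ α
          L[S]≡α = liftVec-greedyLift-finite α∈Δ να≢∞
          ∣S∣≡r : ∣ greedyLift π α ∣ ≡ r
          ∣S∣≡r = trans (sym (sum-liftVec π (greedyLift π α))) (trans (cong sum L[S]≡α) α∈Δ)
        from : IsValuatedMatroid Γ r (M π ν) → IsMConvex Γ r ν
        from ((S , ∣S∣≡r , μS≢∞) , exchange) =
          (liftVec π S , trans (sum-liftVec π S) ∣S∣≡r , μS≢∞) , matroid⇒mConvexExchange exchange

proposition1p4 : ∀ {c ℓ} (Γ : TotallyOrderedAbelianGroup c ℓ)
    (n m r : ℕ) (ν : Vec ℕ n → Γ̄ Γ) (a : Fin n → ℕ) →
    IsMinimalBound Γ r ν a →
    (π : Fin m → Fin n) →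
    (∀ s → ∣ fiber π s ∣ ≡ a s) →
    IsMConvex Γ r ν ⇔ IsValuatedMatroid Γ r (M π ν)
proposition1p4 Γ n m r ν a minimal π ∣fiber∣≡a = mConvex⇔valuatedMatroid Γ π ν fits
  where
  fits : ∀ α → InΔ r α → ν α ≢ ∞ → ∀ u → lookup α u ≤ ∣ fiber π u ∣
  fits α α∈Δ να≢∞ u = subst (lookup α u ≤_) (sym (∣fiber∣≡a u)) (proj₁ (minimal u) α α∈Δ να≢∞)
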